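{- Let $R=(Z,A(R))$ be a finite digraph, $X,M\subseteq Z$ disjoint, $Y\subseteq Z$ with $M\cap Y=\emptyset$ and $M\cap N_R(y)=\emptyset$ for all $y\in Y$, and $\beta:X\to Y$ a map. Assume $X$ is convex in $R$ and there is no walk in $R$ starting in $M$ and ending in $Y$, and no walk starting in $Y$ and ending in $M$. Let $S$ be the digraph with $V(S)=Z$ and $A(S)=A_r\cup A_d\cup A_u$, where $A_r=A(R)\setminus((M\times X)\cup(X\times M))$, $A_d=\{m\beta(x): mx\in A(R)\cap(M\times X)\}$, $A_u=\{\beta(x)m: xm\in A(R)\cap(X\times M)\}$. Let $z_0,\dots,z_I$ be a walk in $S$ and $K=\{i\in\{1,\dots,I\}: z_{i-1}z_i\notin A_r\}$. Then $\#K\le2$, and if $K=\{k,\ell\}$ with $k<\ell$, then there are $m,n\in M$ and $x,y\in X$ with $mx\in A(R^*)$, $yn\in A(R^*)$, $z_{k-1}z_k=m\beta(x)\in A_d$ and $z_{\ell-1}z_\ell=\beta(y)n\in A_u$.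
   Context: Digraphs have finite non-empty vertex set and arc set $A\subseteq V\times V$; $R^*$ is $R$ with loops $vv$ removed. $v,w$ adjacent if $vw$ or $wv$ is an arc; $N_R(v)$ = vertices $w\ne v$ adjacent to $v$. A walk is a sequence $v_0,\dots,v_I$ ($I\ge1$) with $v_{i-1}v_i$ arcs. A set $X$ of vertices is convex iff every walk starting and ending in $X$ lies entirely in $X$. -}

module Defs where

open import Data.Nat using (ℕ; zero; suc; _≤_; _+_)
open import Data.Fin using (Fin; zero; suc; inject₁; fromℕ; _<_)
open import Data.Bool using (Bool; true; false; T; _∧_; _∨_; not)
open import Data.Product using (Σ; ∃; _×_; _,_)
open import Data.Sum using (_⊎_)
open import Relation.Nullary using (¬_)
open import Relation.Binary.PropositionalEquality using (_≡_)

Digraph : ℕ → Set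
Digraph n = Fin n → Fin n → Bool

VSet : ℕ → Set
VSet n = Fin n → Bool

record Walk {n : ℕ} (R : Fin n → Fin n → Set) : Set where
  constructor mkWalk
  field
    len   : ℕ
    len≥1 : 1 ≤ len
    pt    : Fin (suc len) → Fin n
    step  : (j : Fin len) → R (pt (inject₁ j)) (pt (suc j))
open Walk public

start : ∀ {n} {R : Fin n → Fin n → Set} → Walk R → Fin n
start w = pt w zero

end : ∀ {n} {R : Fin n → Fin n → Set} → Walk R → Fin n
end w = pt w (fromℕ (len w))

Arc : ∀ {n} → Digraph n → Fin n → Fin n → Set
Arc A u v = T (A u v)

Convex : ∀ {n} → Digraph n → VSet n → Set
Convex A X = (w : Walk (Arc A)) → T (X (start w)) → T (X (end w)) →
             (i : Fin (suc (len w))) → T (X (pt w i))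

NoWalk : ∀ {n} → Digraph n → VSet n → VSet n → Set
NoWalk A P Q = (w : Walk (Arc A)) → T (P (start w)) → T (Q (end w)) → ⊥'
  where open import Data.Empty renaming (⊥ to ⊥')

Adjacent : ∀ {n} → Digraph n → Fin n → Fin n → Set
Adjacent A v w = T (A v w) ⊎ T (A w v)

InNbhd : ∀ {n} → Digraph n → Fin n → Fin n → Set
InNbhd A v w = ¬ (w ≡ v) × Adjacent A v w

ArcStar : ∀ {n} → Digraph n → Fin n → Fin n → Set
ArcStar A u v = T (A u v) × ¬ (u ≡ v)

Ar : ∀ {n} → Digraph n → (X M : VSet n) → Fin n → Fin n → Bool
Ar A X M u v = A u v ∧ not ((M u ∧ X v) ∨ (X u ∧ M v))

Ad : ∀ {n} → Digraph n → (X M : VSet n) → (β : Fin n → Fin n) → Fin n → Fin n → Set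
Ad A X M β u v = Σ (Fin _) λ x → T (M u) × T (X x) × T (A u x) × (v ≡ β x)

Au : ∀ {n} → Digraph n → (X M : VSet n) → (β : Fin n → Fin n) → Fin n → Fin n → Set
Au A X M β u v = Σ (Fin _) λ x → T (X x) × T (M v) × T (A x v) × (u ≡ β x)

ArcS : ∀ {n} → Digraph n → (X M : VSet n) → (β : Fin n → Fin n) → Fin n → Fin n → Set
ArcS A X M β u v = T (Ar A X M u v) ⊎ Ad A X M β u v ⊎ Au A X M β u v

count : ∀ {I} → (Fin I → Bool) → ℕ
count {zero}  p = 0
count {suc I} p = (if p zero then 1 else 0) + count (λ j → p (suc j))
  where open import Data.Bool using (if_then_else_)

-- K, shifted to 0-based step indices: step j ∈ Fin I is the arc z_j z_{j+1},
-- i.e. paper index i = j+1.  inK j = true iff z_j z_{j+1} ∉ A_r.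
inK : ∀ {n} (A : Digraph n) (X M : VSet n) (β : Fin n → Fin n) →
      (w : Walk (ArcS A X M β)) → Fin (len w) → Bool
inK A X M β w j = not (Ar A X M (pt w (inject₁ j)) (pt w (suc j)))

-- A step of S outside A_r is either a down-step m → β x (from M into β X ⊆ Y) or an
-- up-step β y → n (from Y into M); between two consecutive such steps the walk uses
-- arcs of R only.  Such an R-walk cannot join Y to M, nor M to Y, so a down-step is
-- never followed by another down-step and an up-step never by another up-step.  Nor
-- can an up-step y → n be followed by a down-step m → x: the R-walk y n ⋯ m x would
-- start and end in the convex set X and hence put n ∈ M into X.  So the steps
-- outside A_r form a subsequence of "down, up".
module Submission where

open import Defs
open import Data.Nat using (ℕ; suc; _+_; _≤_; NonZero; z≤n; s≤s)
open import Data.Nat.Properties using (≤-refl)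
open import Data.Fin using (Fin; zero; suc; inject₁; fromℕ; _<_)
open import Data.Fin.Properties using (<⇒≢)
open import Data.Bool using (true; false; T; not; _∧_; if_then_else_)
open import Data.Bool.Properties using (T-∧; T-≡)
open import Data.Empty using (⊥-elim)
open import Data.Product using (Σ; _×_; _,_; proj₁)
open import Data.Sum using (_⊎_; inj₁; inj₂)
open import Function.Bundles using (Equivalence)
open import Relation.Nullary using (¬_)
open import Relation.Binary.PropositionalEquality using (_≡_; refl; sym; subst)
open import Relation.Binary.Construct.Closure.ReflexiveTransitive using (Star; ε; _◅_; _◅◅_)

T-¬not : ∀ {b} → ¬ T (not b) → T b
T-¬not {true}  _ = _
T-¬not {false} h = ⊥-elim (h _)

T-not⇒¬T : ∀ {b} → T (not b) → ¬ T b
T-not⇒¬T {false} _ ()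

module _ {n : ℕ} {R : Fin n → Fin n → Set} where

  length : ∀ {u v} → Star R u v → ℕ
  length ε       = 0
  length (_ ◅ s) = suc (length s)

  points : ∀ {u v} (s : Star R u v) → Fin (suc (length s)) → Fin n
  points {u} _ zero      = u
  points (_ ◅ s) (suc i) = points s i

  points-step : ∀ {u v} (s : Star R u v) (j : Fin (length s)) →
                R (points s (inject₁ j)) (points s (suc j))
  points-step (r ◅ _) zero    = r
  points-step (_ ◅ s) (suc j) = points-step s j

  points-last : ∀ {u v} (s : Star R u v) → points s (fromℕ (length s)) ≡ v
  points-last ε       = refl
  points-last (_ ◅ s) = points-last s

  ◅-walk : ∀ {u v w} → R u v → Star R v w → Walk R
  ◅-walk r s = mkWalk (length (r ◅ s)) (s≤s z≤n) (points (r ◅ s)) (points-step (r ◅ s))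

module _ {V : Set} {R : V → V → Set} where

  prefix-star : ∀ {L} (p : Fin (suc L) → V) (l : Fin L) →
                (∀ j → j < l → R (p (inject₁ j)) (p (suc j))) →
                Star R (p zero) (p (inject₁ l))
  prefix-star p zero    _    = ε
  prefix-star p (suc l) arcs =
    arcs zero (s≤s z≤n) ◅ prefix-star (λ i → p (suc i)) l (λ j j<l → arcs (suc j) (s≤s j<l))

  between-star : ∀ {L} (p : Fin (suc L) → V) (k l : Fin L) → k < l →
                 (∀ j → k < j → j < l → R (p (inject₁ j)) (p (suc j))) →
                 Star R (p (suc k)) (p (inject₁ l))
  between-star p zero    (suc l) _         arcs =
    prefix-star (λ i → p (suc i)) l (λ j j<l → arcs (suc j) (s≤s z≤n) (s≤s j<l))
  between-star p (suc k) (suc l) (s≤s k<l) arcs =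
    between-star (λ i → p (suc i)) k l k<l (λ j k<j j<l → arcs (suc j) (s≤s k<j) (s≤s j<l))

module _ {n : ℕ} (A : Digraph n) where

  NoWalk⇒¬Star : ∀ {P Q : VSet n} {u v} → (∀ {z} → T (P z) → ¬ T (Q z)) → NoWalk A P Q →
                 T (P u) → T (Q v) → ¬ Star (Arc A) u v
  NoWalk⇒¬Star P∩Q=∅ _     pu qv ε       = P∩Q=∅ pu qv
  NoWalk⇒¬Star {Q = Q} _ noPQ pu qv (r ◅ s) =
    noPQ (◅-walk r s) pu (subst (λ z → T (Q z)) (sym (points-last s)) qv)

  Convex-enter : ∀ {X : VSet n} {u v w} → Convex A X →
                 T (X u) → T (A u v) → Star (Arc A) v w → T (X w) → T (X v)
  Convex-enter {X} convex xu r s xw =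
    convex (◅-walk r s) xu (subst (λ z → T (X z)) (sym (points-last s)) xw) (suc zero)

module Rerouting {n : ℕ} (A : Digraph n) (X M Y : VSet n) (β : Fin n → Fin n)
  (X∩M=∅ : ∀ v → ¬ T (X v ∧ M v))
  (M∩Y=∅ : ∀ v → ¬ T (M v ∧ Y v))
  (βX⊆Y : ∀ x → T (X x) → T (Y (β x)))
  (convex : Convex A X)
  (noM⇝Y : NoWalk A M Y)
  (noY⇝M : NoWalk A Y M) where

  Down Up Detour : Fin n → Fin n → Set
  Down = Ad A X M β
  Up   = Au A X M β
  Detour u v = Down u v ⊎ Up u v

  X∌M : ∀ {v} → T (X v) → ¬ T (M v)
  X∌M xv mv = X∩M=∅ _ (Equivalence.from T-∧ (xv , mv))

  M∌Y : ∀ {v} → T (M v) → ¬ T (Y v)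
  M∌Y mv yv = M∩Y=∅ _ (Equivalence.from T-∧ (mv , yv))

  Ar⇒Arc : ∀ {u v} → T (Ar A X M u v) → T (A u v)
  Ar⇒Arc r = proj₁ (Equivalence.to T-∧ r)

  classify : ∀ {u v} → T (not (Ar A X M u v)) → ArcS A X M β u v → Detour u v
  classify outside (inj₁ inside) = ⊥-elim (T-not⇒¬T outside inside)
  classify _       (inj₂ d)      = d

  Down-target∈Y : ∀ {u v} → Down u v → T (Y v)
  Down-target∈Y (x , _ , xx , _ , v≡βx) = subst (λ z → T (Y z)) (sym v≡βx) (βX⊆Y x xx)

  Up-source∈Y : ∀ {u v} → Up u v → T (Y u)
  Up-source∈Y (y , xy , _ , _ , u≡βy) = subst (λ z → T (Y z)) (sym u≡βy) (βX⊆Y y xy)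

  no-Down-after-Down : ∀ {u v u′ v′} → Down u v → Star (Arc A) v u′ → ¬ Down u′ v′
  no-Down-after-Down d s (_ , mu′ , _) =
    NoWalk⇒¬Star A (λ y m → M∌Y m y) noY⇝M (Down-target∈Y d) mu′ s

  no-Up-after-Up : ∀ {u v u′ v′} → Up u v → Star (Arc A) v u′ → ¬ Up u′ v′
  no-Up-after-Up (_ , _ , mv , _) s t = NoWalk⇒¬Star A M∌Y noM⇝Y mv (Up-source∈Y t) s

  no-Down-after-Up : ∀ {u v u′ v′} → Up u v → Star (Arc A) v u′ → ¬ Down u′ v′
  no-Down-after-Up (_ , xy , mv , yv , _) s (_ , _ , xx , u′x , _) =
    X∌M (Convex-enter A convex xy yv (s ◅◅ (u′x ◅ ε)) xx) mv

  down-then-up : ∀ {u v u′ v′} → Detour u v → Star (Arc A) v u′ → Detour u′ v′ →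
                 Down u v × Up u′ v′
  down-then-up (inj₁ d) _ (inj₂ t)  = d , t
  down-then-up (inj₁ d) s (inj₁ d′) = ⊥-elim (no-Down-after-Down d s d′)
  down-then-up (inj₂ t) s (inj₁ d′) = ⊥-elim (no-Down-after-Up t s d′)
  down-then-up (inj₂ t) s (inj₂ t′) = ⊥-elim (no-Up-after-Up t s t′)

  -- Ahead u c: the possible futures of an S-walk from u with c steps outside A_r,
  -- recording its first such step together with the R-walk leading to it.
  data Ahead (u : Fin n) : ℕ → Set where
    clear : Ahead u 0
    up    : ∀ {u′ v′} → Star (Arc A) u u′ → Up u′ v′ → Ahead u 1
    down  : ∀ {c u′ v′} → Star (Arc A) u u′ → Down u′ v′ → c ≤ 2 → Ahead u c

  Ahead⇒≤2 : ∀ {u c} → Ahead u c → c ≤ 2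
  Ahead⇒≤2 clear        = z≤n
  Ahead⇒≤2 (up _ _)     = s≤s z≤n
  Ahead⇒≤2 (down _ _ h) = h

  Ahead-◅ : ∀ {u v c} → T (A u v) → Ahead v c → Ahead u c
  Ahead-◅ _ clear        = clear
  Ahead-◅ r (up s t)     = up (r ◅ s) t
  Ahead-◅ r (down s d h) = down (r ◅ s) d h

  Ahead-step : ∀ {u v c} → ArcS A X M β u v → Ahead v c →
               Ahead u ((if not (Ar A X M u v) then 1 else 0) + c)
  Ahead-step {u} {v} _ a with Ar A X M u v in inside
  Ahead-step _              a             | true  = Ahead-◅ (Ar⇒Arc (Equivalence.from T-≡ inside)) a
  Ahead-step (inj₂ (inj₁ d)) clear         | false = down ε d (s≤s z≤n)
  Ahead-step (inj₂ (inj₁ d)) (up _ _)      | false = down ε d ≤-refl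
  Ahead-step (inj₂ (inj₁ d)) (down s d′ _) | false = ⊥-elim (no-Down-after-Down d s d′)
  Ahead-step (inj₂ (inj₂ t)) clear         | false = up ε t
  Ahead-step (inj₂ (inj₂ t)) (up s t′)     | false = ⊥-elim (no-Up-after-Up t s t′)
  Ahead-step (inj₂ (inj₂ t)) (down s d′ _) | false = ⊥-elim (no-Down-after-Up t s d′)

  ahead : ∀ {L} (p : Fin (suc L) → Fin n) → (∀ j → ArcS A X M β (p (inject₁ j)) (p (suc j))) →
          Ahead (p zero) (count (λ j → not (Ar A X M (p (inject₁ j)) (p (suc j)))))
  ahead {0}     p arcs = clear
  ahead {suc L} p arcs = Ahead-step (arcs zero) (ahead (λ i → p (suc i)) (λ j → arcs (suc j)))

  DownUp : Fin n → Fin n → Fin n → Fin n → Set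
  DownUp u v u′ v′ =
    Σ (Fin n) λ m → Σ (Fin n) λ n′ → Σ (Fin n) λ x → Σ (Fin n) λ y →
      T (M m) × T (M n′) × T (X x) × T (X y)
      × ArcStar A m x × ArcStar A y n′
      × u ≡ m × v ≡ β x × Down m (β x)
      × u′ ≡ β y × v′ ≡ n′ × Up (β y) n′

  Down×Up⇒DownUp : ∀ {u v u′ v′} → Down u v × Up u′ v′ → DownUp u v u′ v′
  Down×Up⇒DownUp {u} {v′ = v′} ((x , mu , xx , ux , v≡βx) , (y , xy , mv′ , yv′ , u′≡βy)) =
    u , v′ , x , y , mu , mv′ , xx , xy ,
    (ux , λ u≡x → X∌M xx (subst (λ z → T (M z)) u≡x mu)) ,
    (yv′ , λ y≡v′ → X∌M xy (subst (λ z → T (M z)) (sym y≡v′) mv′)) ,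
    refl , v≡βx , (x , mu , xx , ux , refl) , u′≡βy , refl , (y , xy , mv′ , yv′ , refl)

lemma6 : {n : ℕ} → .{{_ : NonZero n}} → (A : Digraph n) → (X M Y : VSet n) → (β : Fin n → Fin n) →
    (∀ v → ¬ T (X v ∧ M v)) →
    (∀ v → ¬ T (M v ∧ Y v)) →
    (∀ y w → T (Y y) → InNbhd A y w → ¬ T (M w)) →
    (∀ x → T (X x) → T (Y (β x))) →
    Convex A X →
    NoWalk A M Y →
    NoWalk A Y M →
    (w : Walk (ArcS A X M β)) →
    (count (inK A X M β w) ≤ 2)
    × ((k l : Fin (len w)) → k < l →
       (∀ j → T (inK A X M β w j) → (j ≡ k ⊎ j ≡ l)) →
       T (inK A X M β w k) → T (inK A X M β w l) →
       Σ (Fin n) λ m → Σ (Fin n) λ n' → Σ (Fin n) λ x → Σ (Fin n) λ y →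
         T (M m) × T (M n') × T (X x) × T (X y)
         × ArcStar A m x × ArcStar A y n'
         × pt w (inject₁ k) ≡ m × pt w (suc k) ≡ β x
         × Ad A X M β m (β x)
         × pt w (inject₁ l) ≡ β y × pt w (suc l) ≡ n'
         × Au A X M β (β y) n')
lemma6 A X M Y β X∩M=∅ M∩Y=∅ _ βX⊆Y convex noM⇝Y noY⇝M w =
  Ahead⇒≤2 (ahead (pt w) (step w)) , two-detours
  where
  open Rerouting A X M Y β X∩M=∅ M∩Y=∅ βX⊆Y convex noM⇝Y noY⇝M

  two-detours : (k l : Fin (len w)) → k < l → (∀ j → T (inK A X M β w j) → j ≡ k ⊎ j ≡ l) →
                T (inK A X M β w k) → T (inK A X M β w l) →
                DownUp (pt w (inject₁ k)) (pt w (suc k)) (pt w (inject₁ l)) (pt w (suc l))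
  two-detours k l k<l only-k-l k∈K l∈K =
    Down×Up⇒DownUp (down-then-up (classify k∈K (step w k)) (between-star (pt w) k l k<l inside)
                                 (classify l∈K (step w l)))
    where
    inside : ∀ j → k < j → j < l → T (A (pt w (inject₁ j)) (pt w (suc j)))
    inside j k<j j<l = Ar⇒Arc (T-¬not λ j∈K → excluded (only-k-l j j∈K))
      where
      excluded : ¬ (j ≡ k ⊎ j ≡ l)
      excluded (inj₁ j≡k) = <⇒≢ k<j (sym j≡k)
      excluded (inj₂ j≡l) = <⇒≢ j<l j≡l
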